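{- Let $\mathcal{D}$ be a self-orthogonal $t$-$(v,k,\lambda)$ design with $k \equiv 0 \pmod 4$, and let $\lambda_j = \lambda\binom{v-j}{t-j}/\binom{k-j}{t-j}$ for $0\le j\le t$. For an integer $w$ with $0<w$, consider the linear system in the unknowns $n_i$, $i$ even with $0\le i\le \min\{k,w\}$: $$\sum_{i=0}^{\min\{k,w\}}\binom{i}{j}n_{i}=\lambda_{j}\binom{w}{j}\qquad(j=0,1,\ldots,t),$$ where $n_i=0$ for odd $i$. (i) If for some $w$ this system has no solution $(n_0,n_2,\ldots)$ consisting of nonnegative integers, then $C(\mathcal{D})^\perp$ contains no vector of weight $w$. (ii) If for each $w$ with $0<w<v$ and $w\not\equiv 0\pmod 4$ this system has no solution consisting of nonnegative integers, then $C(\mathcal{D})$ is a doubly even self-dual code.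
   Context: A $t$-$(v,k,\lambda)$ design is a set of $v$ points with a collection of $k$-subsets (blocks), with no repeated blocks, such that every $t$-subset of points lies in exactly $\lambda$ blocks. It is self-orthogonal if the cardinality of the intersection of any two distinct blocks has the same parity as $k$. $C(\mathcal{D})$ denotes the binary linear code of length $v$ spanned over $\mathbb{F}_2$ by the rows of the block-point incidence matrix of $\mathcal{D}$ (i.e., by the characteristic vectors of the blocks), and $C(\mathcal{D})^\perp$ its dual under the standard inner product. A code is doubly even if all weights are divisible by $4$, self-dual if it equals its dual. -}

module Defs where

open import Data.Nat using (ℕ; suc; _+_; _*_; _∸_; _⊓_; _%_; _≤_; _<_)
open import Data.Nat.Divisibility using (_∣_)
open import Data.Nat.Combinatorics using (_C_)
open import Data.Bool using (Bool; _xor_)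
open import Data.Vec using (Vec; zipWith)
open import Data.List using (List; map; upTo; filter; length)
open import Data.Nat.ListAction using (sum)
open import Data.List.Membership.Propositional using (_∈_)
open import Data.List.Relation.Unary.All using (All)
open import Data.List.Relation.Unary.Unique.Propositional using (Unique)
open import Data.Fin.Subset using (Subset; ∣_∣; _∩_; _⊆_; ⊥)
open import Data.Fin.Subset.Properties using (_⊆?_)
open import Data.Product using (Σ; _×_)
open import Relation.Binary.PropositionalEquality using (_≡_; _≢_)
open import Relation.Nullary using (¬_)

-- Points are Fin v; a block / a binary word of length v is a Subset v = Vec Bool v
-- (characteristic vector).  Hamming weight = ∣ x ∣.

_⊕_ : ∀ {v} → Subset v → Subset v → Subset v
_⊕_ = zipWith _xor_

blocksContaining : ∀ {v} → List (Subset v) → Subset v → ℕ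
blocksContaining B S = length (filter (λ b → S ⊆? b) B)

IsDesign : (t v k lam : ℕ) → List (Subset v) → Set
IsDesign t v k lam B =
  Unique B × All (λ b → ∣ b ∣ ≡ k) B ×
  (∀ (S : Subset v) → ∣ S ∣ ≡ t → blocksContaining B S ≡ lam)

SelfOrthogonal : ∀ {v} → ℕ → List (Subset v) → Set
SelfOrthogonal {v} k B =
  ∀ (b b′ : Subset v) → b ∈ B → b′ ∈ B → b ≢ b′ → ∣ b ∩ b′ ∣ % 2 ≡ k % 2

data InCode {v} (B : List (Subset v)) : Subset v → Set where
  zeroC : InCode B ⊥
  addC  : ∀ {b x} → b ∈ B → InCode B x → InCode B (b ⊕ x)

-- Standard inner product over F₂ is the parity of ∣ x ∩ y ∣.
-- C(D)^⊥: words orthogonal to every codeword of C(D).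
InDual : ∀ {v} → List (Subset v) → Subset v → Set
InDual {v} B x = ∀ (y : Subset v) → InCode B y → 2 ∣ ∣ x ∩ y ∣

DoublyEven : ∀ {v} → (Subset v → Set) → Set
DoublyEven {v} C = ∀ (x : Subset v) → C x → 4 ∣ ∣ x ∣

SelfDual : ∀ {v} → List (Subset v) → Set
SelfDual {v} B = ∀ (x : Subset v) → (InCode B x → InDual B x) × (InDual B x → InCode B x)

-- The linear system of the lemma, with λ_j = λ·C(v-j,t-j)/C(k-j,t-j)
-- cleared of its (nonzero, as t ≤ k) denominator:
--   (Σ_{i=0}^{min(k,w)} C(i,j) n_i) · C(k-j,t-j) = λ · C(v-j,t-j) · C(w,j),  j = 0..t,
-- in unknowns n_i ∈ ℕ with n_i = 0 for odd i.
SystemSolvable : (t v k lam w : ℕ) → Set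
SystemSolvable t v k lam w =
  Σ (ℕ → ℕ) λ n →
    (∀ i → ¬ (2 ∣ i) → n i ≡ 0) ×
    (∀ j → j ≤ t →
      sum (map (λ i → (i C j) * n i) (upTo (suc (k ⊓ w)))) * ((k ∸ j) C (t ∸ j))
        ≡ lam * ((v ∸ j) C (t ∸ j)) * (w C j))

-- For a word x of C(D)^⊥ let n_i be the number of blocks meeting x in exactly i points.  Since
-- x is orthogonal to every block, n_i = 0 for odd i, and counting the pairs (S, b) with S a
-- j-subset of x ∩ b gives Σ_i C(i,j) n_i = λ_j C(|x|,j): the λ_j blocks through S are
-- themselves counted by the pairs (T, b) with S ⊆ T ⊆ b, |T| = t.  So (n_i) solves the system
-- for w = |x|, which is (i).  For (ii), self-orthogonality and 4 ∣ k give C ⊆ C^⊥.  By (i)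
-- every word of C^⊥ of weight 0 < w < v is doubly even; the all-one word, if it lies in C^⊥,
-- differs from a block b in a dual word of weight v − k, so it is doubly even too.  A binary
-- code whose words all have weight ≡ 0 (mod 4) is self-orthogonal, and a word orthogonal to
-- all of C^⊥ lies in C, so C^⊥ ⊆ C.

module Submission where

open import Data.Bool using (if_then_else_; _xor_)
open import Data.Bool.Properties using (xor-assoc; xor-same; xor-identityʳ; ∧-distribˡ-xor)
import Data.Bool.Properties as Bool
open import Data.Fin.Subset using (Subset; ∣_∣; _∩_; _⊆_; ⊥; ⊤; inside; outside)
open import Data.Fin.Subset.Properties
  using ( _⊆?_; ⊆-trans; ⊥⊆; ⊆⊤; drop-∷-⊆; p⊆q⇒∣p∣≤∣q∣; p∩q⊆p; p∩q⊆q; x∈p∩q⁺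
        ; ∩-comm; ∩-idem; ∩-identityˡ; ∩-zeroˡ; ∩-zeroʳ
        ; ∣⊥∣≡0; ∣⊤∣≡n; ∣p∣≤n; ∣p∣≡n⇒p≡⊤; ∣p∩q∣≤∣p∣⊓∣q∣ )
open import Data.List using (List; []; _∷_; map; upTo; applyUpTo; filter; length; _++_)
open import Data.List.Membership.Propositional using (_∈_)
open import Data.List.Properties using (map-applyUpTo)
open import Data.List.Relation.Unary.All using () renaming (lookup to All-lookup)
open import Data.List.Relation.Unary.Any using (here; there)
open import Data.Nat using (ℕ; zero; suc; _+_; _*_; _∸_; _⊓_; _≤_; _<_; z≤n; s≤s; parity; >-nonZero)
open import Data.Nat.Combinatorics using (_C_; nCk+nC[k+1]≡[n+1]C[k+1])
open import Data.Nat.Divisibility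
  using (_∣_; _∣?_; divides; ∣-refl; ∣-trans; ∣⇒≤; ∣m∣n⇒∣m+n; ∣m+n∣m⇒∣n; m%n≡0⇒n∣m; n∣m⇒m%n≡0)
open import Data.Nat.ListAction using (sum)
open import Data.Nat.Properties
open import Algebra.Properties.CommutativeSemigroup +-commutativeSemigroup
  using () renaming (interchange to +-interchange)
open import Data.Parity using (Parity; 0ℙ; 1ℙ)
import Data.Parity as ℙ
import Data.Parity.Properties as ℙ
open import Data.Product using (Σ; _×_; _,_; proj₁; proj₂)
import Data.Product as Product
open import Data.Sum using (_⊎_; inj₁; inj₂)
open import Data.Vec.Base using ([]; _∷_; _[_]=_)
open import Data.Vec.Properties using (≡-dec; zipWith-identityʳ; zipWith-distribˡ)
open import Defs
open import Function using (_∘_; id)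
open import Relation.Binary.PropositionalEquality
open import Relation.Nullary using (¬_; Dec; yes; no; does; contradiction)
open import Relation.Nullary.Decidable using (_×-dec_; decidable-stable)
open import Relation.Unary using (Pred; Decidable)

private variable
  A A′ : Set
  P Q : Set

∑ : List A → (A → ℕ) → ℕ
∑ xs f = sum (map f xs)

∑-cong : ∀ (xs : List A) {f g : A → ℕ} → (∀ x → f x ≡ g x) → ∑ xs f ≡ ∑ xs g
∑-cong []       f≗g = refl
∑-cong (x ∷ xs) f≗g = cong₂ _+_ (f≗g x) (∑-cong xs f≗g)

∑-cong-∈ : ∀ (xs : List A) {f g : A → ℕ} → (∀ {x} → x ∈ xs → f x ≡ g x) → ∑ xs f ≡ ∑ xs g
∑-cong-∈ []       f≗g = refl
∑-cong-∈ (x ∷ xs) f≗g = cong₂ _+_ (f≗g (here refl)) (∑-cong-∈ xs (f≗g ∘ there))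

∑-zero : ∀ (xs : List A) → ∑ xs (λ _ → 0) ≡ 0
∑-zero []       = refl
∑-zero (x ∷ xs) = ∑-zero xs

∑-++ : ∀ (xs ys : List A) (f : A → ℕ) → ∑ (xs ++ ys) f ≡ ∑ xs f + ∑ ys f
∑-++ []       ys f = refl
∑-++ (x ∷ xs) ys f = trans (cong (f x +_) (∑-++ xs ys f)) (sym (+-assoc (f x) _ _))

∑-map : (g : A′ → A) (xs : List A′) (f : A → ℕ) → ∑ (map g xs) f ≡ ∑ xs (f ∘ g)
∑-map g []       f = refl
∑-map g (x ∷ xs) f = cong (f (g x) +_) (∑-map g xs f)

∑-+ : ∀ (xs : List A) (f g : A → ℕ) → ∑ xs (λ x → f x + g x) ≡ ∑ xs f + ∑ xs g
∑-+ []       f g = refl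
∑-+ (x ∷ xs) f g = trans (cong (f x + g x +_) (∑-+ xs f g)) (+-interchange (f x) (g x) _ _)

∑-*ˡ : ∀ (xs : List A) (c : ℕ) (f : A → ℕ) → ∑ xs (λ x → c * f x) ≡ c * ∑ xs f
∑-*ˡ []       c f = sym (*-zeroʳ c)
∑-*ˡ (x ∷ xs) c f = trans (cong (c * f x +_) (∑-*ˡ xs c f)) (sym (*-distribˡ-+ c (f x) _))

∑-*ʳ : ∀ (xs : List A) (c : ℕ) (f : A → ℕ) → ∑ xs (λ x → f x * c) ≡ ∑ xs f * c
∑-*ʳ xs c f = trans (∑-cong xs (λ x → *-comm (f x) c)) (trans (∑-*ˡ xs c f) (*-comm c _))

∑-swap : ∀ (xs : List A) (ys : List A′) (f : A → A′ → ℕ) →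
         ∑ xs (λ x → ∑ ys (f x)) ≡ ∑ ys (λ y → ∑ xs (λ x → f x y))
∑-swap []       ys f = sym (∑-zero ys)
∑-swap (x ∷ xs) ys f =
  trans (cong (∑ ys (f x) +_) (∑-swap xs ys f)) (sym (∑-+ ys (f x) (λ y → ∑ xs (λ x′ → f x′ y))))

∑-nonempty : ∀ (xs : List A) {f : A → ℕ} → 0 < ∑ xs f → Σ A (_∈ xs)
∑-nonempty (x ∷ xs) _ = x , here refl

∑-applyUpTo-suc : ∀ m (f : ℕ → ℕ) → ∑ (applyUpTo suc m) f ≡ ∑ (upTo m) (f ∘ suc)
∑-applyUpTo-suc m f = trans (cong (λ xs → ∑ xs f) (sym (map-applyUpTo id suc m))) (∑-map suc (upTo m) f)

𝟙 : Dec P → ℕ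
𝟙 P? = if does P? then 1 else 0

𝟙-× : (P? : Dec P) (Q? : Dec Q) → 𝟙 (P? ×-dec Q?) ≡ 𝟙 P? * 𝟙 Q?
𝟙-× (yes _) (yes _) = refl
𝟙-× (yes _) (no _)  = refl
𝟙-× (no _)  _       = refl

𝟙-cong : (P → Q) → (Q → P) → (P? : Dec P) (Q? : Dec Q) → 𝟙 P? ≡ 𝟙 Q?
𝟙-cong P→Q Q→P (yes _) (yes _) = refl
𝟙-cong P→Q Q→P (yes p) (no ¬q) = contradiction (P→Q p) ¬q
𝟙-cong P→Q Q→P (no ¬p) (yes q) = contradiction (Q→P q) ¬p
𝟙-cong P→Q Q→P (no _)  (no _)  = refl

𝟙-yes : (P? : Dec P) → P → 𝟙 P? ≡ 1
𝟙-yes (yes _) p = refl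
𝟙-yes (no ¬p) p = contradiction p ¬p

𝟙-no : (P? : Dec P) → ¬ P → 𝟙 P? ≡ 0
𝟙-no (yes p) ¬p = contradiction p ¬p
𝟙-no (no _)  ¬p = refl

𝟙-*-cong : (P? : Dec P) {m n : ℕ} → (P → m ≡ n) → 𝟙 P? * m ≡ 𝟙 P? * n
𝟙-*-cong (yes p) m≡n = cong (_+ 0) (m≡n p)
𝟙-*-cong (no _)  m≡n = refl

length-filter≡∑𝟙 : ∀ {P : Pred A _} (P? : Decidable P) xs → length (filter P? xs) ≡ ∑ xs (𝟙 ∘ P?)
length-filter≡∑𝟙 P? []       = refl
length-filter≡∑𝟙 P? (x ∷ xs) with P? x
... | yes _ = cong suc (length-filter≡∑𝟙 P? xs)
... | no _  = length-filter≡∑𝟙 P? xs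

∑-upTo-𝟙≟ : ∀ m a (g : ℕ → ℕ) → a ≤ m → ∑ (upTo (suc m)) (λ i → 𝟙 (a ≟ i) * g i) ≡ g a
∑-upTo-𝟙≟ m zero g _ = begin
  g 0 + 0 + ∑ (applyUpTo suc m) (λ i → 𝟙 (0 ≟ i) * g i)
    ≡⟨ cong₂ _+_ (+-identityʳ (g 0)) (∑-applyUpTo-suc m _) ⟩
  g 0 + ∑ (upTo m) (λ _ → 0)
    ≡⟨ trans (cong (g 0 +_) (∑-zero (upTo m))) (+-identityʳ (g 0)) ⟩
  g 0 ∎
  where open ≡-Reasoning
∑-upTo-𝟙≟ (suc m) (suc a) g (s≤s a≤m) = begin
  ∑ (applyUpTo suc (suc m)) (λ i → 𝟙 (suc a ≟ i) * g i) ≡⟨ ∑-applyUpTo-suc (suc m) _ ⟩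
  ∑ (upTo (suc m)) (λ i → 𝟙 (a ≟ i) * g (suc i))       ≡⟨ ∑-upTo-𝟙≟ m a (g ∘ suc) a≤m ⟩
  g (suc a)                                            ∎
  where open ≡-Reasoning

∑-fibres : ∀ (xs : List A) (a : A → ℕ) (g : ℕ → ℕ) m → (∀ {x} → x ∈ xs → a x ≤ m) →
           ∑ (upTo (suc m)) (λ i → g i * ∑ xs (λ x → 𝟙 (a x ≟ i))) ≡ ∑ xs (g ∘ a)
∑-fibres xs a g m bounded = begin
  ∑ (upTo (suc m)) (λ i → g i * ∑ xs (λ x → 𝟙 (a x ≟ i)))
    ≡⟨ ∑-cong (upTo (suc m)) (λ i → trans (*-comm (g i) _) (sym (∑-*ʳ xs (g i) _))) ⟩
  ∑ (upTo (suc m)) (λ i → ∑ xs (λ x → 𝟙 (a x ≟ i) * g i))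
    ≡⟨ ∑-swap (upTo (suc m)) xs _ ⟩
  ∑ xs (λ x → ∑ (upTo (suc m)) (λ i → 𝟙 (a x ≟ i) * g i))
    ≡⟨ ∑-cong-∈ xs (λ x∈xs → ∑-upTo-𝟙≟ m _ g (bounded x∈xs)) ⟩
  ∑ xs (g ∘ a) ∎
  where open ≡-Reasoning

subsets : ∀ v → List (Subset v)
subsets zero    = [] ∷ []
subsets (suc v) = map (outside ∷_) (subsets v) ++ map (inside ∷_) (subsets v)

∑-subsets-suc : ∀ {v} (F : Subset (suc v) → ℕ) →
  ∑ (subsets (suc v)) F ≡ ∑ (subsets v) (F ∘ (outside ∷_)) + ∑ (subsets v) (F ∘ (inside ∷_))
∑-subsets-suc {v} F = trans (∑-++ (map (outside ∷_) (subsets v)) _ F)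
  (cong₂ _+_ (∑-map (outside ∷_) (subsets v) F) (∑-map (inside ∷_) (subsets v) F))

subset-of-size : ∀ {v} m → m ≤ v → Σ (Subset v) λ S → ∣ S ∣ ≡ m
subset-of-size {v}     zero    _         = ⊥ , ∣⊥∣≡0 v
subset-of-size {suc v} (suc m) (s≤s m≤v) = Product.map (inside ∷_) (cong suc) (subset-of-size m m≤v)

inside∷⊈outside∷ : ∀ {n} {p q : Subset n} → ¬ (inside ∷ p ⊆ outside ∷ q)
inside∷⊈outside∷ p⊆q with p⊆q _[_]=_.here
... | ()

module _ {v : ℕ} where

  inInterval : Subset v → Subset v → ℕ → Subset v → ℕ
  inInterval s u m T = 𝟙 (s ⊆? T ×-dec T ⊆? u ×-dec ∣ T ∣ ≟ m)

  intervalCount : Subset v → Subset v → ℕ → ℕ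
  intervalCount s u m = ∑ (subsets v) (inInterval s u m)

  inInterval≡0 : ∀ s u m T → ¬ (s ⊆ T × T ⊆ u × ∣ T ∣ ≡ m) → inInterval s u m T ≡ 0
  inInterval≡0 s u m T = 𝟙-no (s ⊆? T ×-dec T ⊆? u ×-dec ∣ T ∣ ≟ m)

module _ {v} (s u : Subset v) where

  intervalCount-outside-outside : ∀ m → intervalCount (outside ∷ s) (outside ∷ u) m ≡ intervalCount s u m
  intervalCount-outside-outside m = begin
    intervalCount (outside ∷ s) (outside ∷ u) m
      ≡⟨ ∑-subsets-suc {v} _ ⟩
    intervalCount s u m + ∑ (subsets v) (inInterval (outside ∷ s) (outside ∷ u) m ∘ (inside ∷_))
      ≡⟨ cong (intervalCount s u m +_) (trans (∑-cong (subsets v) no-inside) (∑-zero (subsets v))) ⟩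
    intervalCount s u m + 0
      ≡⟨ +-identityʳ _ ⟩
    intervalCount s u m ∎
    where
    open ≡-Reasoning
    no-inside : ∀ T → inInterval (outside ∷ s) (outside ∷ u) m (inside ∷ T) ≡ 0
    no-inside T = inInterval≡0 (outside ∷ s) (outside ∷ u) m (inside ∷ T)
      λ (_ , T⊆u , _) → inside∷⊈outside∷ T⊆u

  intervalCount-outside-inside-suc : ∀ m →
    intervalCount (outside ∷ s) (inside ∷ u) (suc m) ≡ intervalCount s u (suc m) + intervalCount s u m
  intervalCount-outside-inside-suc m = ∑-subsets-suc {v} _

  intervalCount-outside-inside-≤ : ∀ m → m ≤ ∣ s ∣ →
    intervalCount (outside ∷ s) (inside ∷ u) m ≡ intervalCount s u m
  intervalCount-outside-inside-≤ m m≤∣s∣ = begin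
    intervalCount (outside ∷ s) (inside ∷ u) m
      ≡⟨ ∑-subsets-suc {v} _ ⟩
    intervalCount s u m + ∑ (subsets v) (inInterval (outside ∷ s) (inside ∷ u) m ∘ (inside ∷_))
      ≡⟨ cong (intervalCount s u m +_) (trans (∑-cong (subsets v) too-large) (∑-zero (subsets v))) ⟩
    intervalCount s u m + 0
      ≡⟨ +-identityʳ _ ⟩
    intervalCount s u m ∎
    where
    open ≡-Reasoning
    too-large : ∀ T → inInterval (outside ∷ s) (inside ∷ u) m (inside ∷ T) ≡ 0
    too-large T = inInterval≡0 (outside ∷ s) (inside ∷ u) m (inside ∷ T) λ (s⊆T , _ , ∣T∣+1≡m) →
      <-irrefl refl (≤-trans (≤-reflexive ∣T∣+1≡m) (≤-trans m≤∣s∣ (p⊆q⇒∣p∣≤∣q∣ {p = s} {T} (drop-∷-⊆ s⊆T))))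

  intervalCount-inside-inside-suc : ∀ m →
    intervalCount (inside ∷ s) (inside ∷ u) (suc m) ≡ intervalCount s u m
  intervalCount-inside-inside-suc m = begin
    intervalCount (inside ∷ s) (inside ∷ u) (suc m)
      ≡⟨ ∑-subsets-suc {v} _ ⟩
    ∑ (subsets v) (λ _ → 0) + intervalCount s u m
      ≡⟨ cong (_+ intervalCount s u m) (∑-zero (subsets v)) ⟩
    intervalCount s u m ∎
    where open ≡-Reasoning

intervalCount-binomial : ∀ {v} (s u : Subset v) → s ⊆ u → ∀ r →
  intervalCount s u (∣ s ∣ + r) ≡ (∣ u ∣ ∸ ∣ s ∣) C r
intervalCount-binomial [] [] _ zero    = refl
intervalCount-binomial [] [] _ (suc r) = refl
intervalCount-binomial (outside ∷ s) (outside ∷ u) s⊆u r =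
  trans (intervalCount-outside-outside s u _) (intervalCount-binomial s u (drop-∷-⊆ s⊆u) r)
intervalCount-binomial (outside ∷ s) (inside ∷ u) s⊆u zero =
  trans (intervalCount-outside-inside-≤ s u _ (≤-reflexive (+-identityʳ ∣ s ∣)))
        (intervalCount-binomial s u (drop-∷-⊆ s⊆u) 0)
intervalCount-binomial (outside ∷ s) (inside ∷ u) s⊆u (suc r) = begin
  intervalCount (outside ∷ s) (inside ∷ u) (∣ s ∣ + suc r)
    ≡⟨ cong (intervalCount (outside ∷ s) (inside ∷ u)) (+-suc ∣ s ∣ r) ⟩
  intervalCount (outside ∷ s) (inside ∷ u) (suc (∣ s ∣ + r))
    ≡⟨ intervalCount-outside-inside-suc s u (∣ s ∣ + r) ⟩
  intervalCount s u (suc (∣ s ∣ + r)) + intervalCount s u (∣ s ∣ + r)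
    ≡⟨ cong (_+ intervalCount s u (∣ s ∣ + r)) (cong (intervalCount s u) (sym (+-suc ∣ s ∣ r))) ⟩
  intervalCount s u (∣ s ∣ + suc r) + intervalCount s u (∣ s ∣ + r)
    ≡⟨ cong₂ _+_ (intervalCount-binomial s u s⊆u′ (suc r)) (intervalCount-binomial s u s⊆u′ r) ⟩
  d C suc r + d C r
    ≡⟨ trans (+-comm (d C suc r) _) (nCk+nC[k+1]≡[n+1]C[k+1] d r) ⟩
  suc d C suc r
    ≡⟨ cong (_C suc r) (sym (+-∸-assoc 1 (p⊆q⇒∣p∣≤∣q∣ s⊆u′))) ⟩
  (suc ∣ u ∣ ∸ ∣ s ∣) C suc r ∎
  where
  open ≡-Reasoning
  s⊆u′ = drop-∷-⊆ s⊆u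
  d = ∣ u ∣ ∸ ∣ s ∣
intervalCount-binomial (inside ∷ s) (inside ∷ u) s⊆u r =
  trans (intervalCount-inside-inside-suc s u _) (intervalCount-binomial s u (drop-∷-⊆ s⊆u) r)
intervalCount-binomial (inside ∷ s) (outside ∷ u) s⊆u r =
  contradiction (λ {x} → s⊆u {x}) inside∷⊈outside∷

intervalCount-∅ : ∀ {v} (s u : Subset v) m → ¬ s ⊆ u → intervalCount s u m ≡ 0
intervalCount-∅ {v} s u m s⊈u = trans
  (∑-cong (subsets v) λ T → inInterval≡0 s u m T λ (s⊆T , T⊆u , _) → s⊈u (⊆-trans s⊆T T⊆u))
  (∑-zero (subsets v))

intervalCount≡ : ∀ {v} (s u : Subset v) m → ∣ s ∣ ≤ m →
  intervalCount s u m ≡ 𝟙 (s ⊆? u) * ((∣ u ∣ ∸ ∣ s ∣) C (m ∸ ∣ s ∣))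
intervalCount≡ s u m ∣s∣≤m with s ⊆? u
... | no s⊈u  = intervalCount-∅ s u m s⊈u
... | yes s⊆u = begin
  intervalCount s u m                        ≡⟨ cong (intervalCount s u) (sym (m+[n∸m]≡n ∣s∣≤m)) ⟩
  intervalCount s u (∣ s ∣ + (m ∸ ∣ s ∣))   ≡⟨ intervalCount-binomial s u s⊆u (m ∸ ∣ s ∣) ⟩
  (∣ u ∣ ∸ ∣ s ∣) C (m ∸ ∣ s ∣)             ≡⟨ sym (+-identityʳ _) ⟩
  1 * ((∣ u ∣ ∸ ∣ s ∣) C (m ∸ ∣ s ∣))       ∎
  where open ≡-Reasoning

intervalCount-⊥ : ∀ {v} (u : Subset v) j → intervalCount ⊥ u j ≡ ∣ u ∣ C j
intervalCount-⊥ {v} u j =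
  subst (λ z → intervalCount ⊥ u (z + j) ≡ (∣ u ∣ ∸ z) C j) (∣⊥∣≡0 v) (intervalCount-binomial ⊥ u ⊥⊆ j)

intervalCount-⊤ : ∀ {v} (S : Subset v) m → ∣ S ∣ ≤ m → intervalCount S ⊤ m ≡ (v ∸ ∣ S ∣) C (m ∸ ∣ S ∣)
intervalCount-⊤ {v} S m ∣S∣≤m = begin
  intervalCount S ⊤ m
    ≡⟨ intervalCount≡ S ⊤ m ∣S∣≤m ⟩
  𝟙 (S ⊆? ⊤) * ((∣ ⊤ {v} ∣ ∸ ∣ S ∣) C (m ∸ ∣ S ∣))
    ≡⟨ cong₂ (λ i n → i * ((n ∸ ∣ S ∣) C (m ∸ ∣ S ∣))) (𝟙-yes (S ⊆? ⊤) ⊆⊤) (∣⊤∣≡n v) ⟩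
  1 * ((v ∸ ∣ S ∣) C (m ∸ ∣ S ∣))
    ≡⟨ +-identityʳ _ ⟩
  (v ∸ ∣ S ∣) C (m ∸ ∣ S ∣) ∎
  where open ≡-Reasoning

replication : ∀ {v} → List (Subset v) → Subset v → ℕ
replication B T = ∑ B (λ b → 𝟙 (T ⊆? b))

inInterval-∩ : ∀ {v} (s u b : Subset v) m T → inInterval s (u ∩ b) m T ≡ inInterval s u m T * 𝟙 (T ⊆? b)
inInterval-∩ s u b m T = trans
  (𝟙-cong split join (s ⊆? T ×-dec T ⊆? u ∩ b ×-dec ∣ T ∣ ≟ m) (T∈[s,u]? ×-dec T ⊆? b))
  (𝟙-× T∈[s,u]? (T ⊆? b))
  where
  T∈[s,u]? = s ⊆? T ×-dec T ⊆? u ×-dec ∣ T ∣ ≟ m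
  split : s ⊆ T × T ⊆ u ∩ b × ∣ T ∣ ≡ m → (s ⊆ T × T ⊆ u × ∣ T ∣ ≡ m) × T ⊆ b
  split (s⊆T , T⊆u∩b , ∣T∣≡m) = (s⊆T , p∩q⊆p u b ∘ T⊆u∩b , ∣T∣≡m) , p∩q⊆q u b ∘ T⊆u∩b
  join : (s ⊆ T × T ⊆ u × ∣ T ∣ ≡ m) × T ⊆ b → s ⊆ T × T ⊆ u ∩ b × ∣ T ∣ ≡ m
  join ((s⊆T , T⊆u , ∣T∣≡m) , T⊆b) = s⊆T , (λ x∈T → x∈p∩q⁺ (T⊆u x∈T , T⊆b x∈T)) , ∣T∣≡m

-- Double counting of the pairs (T , b) with s ⊆ T ⊆ u ∩ b and ∣ T ∣ = m.
∑-intervalCount-∩ : ∀ {v} (B : List (Subset v)) s u m →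
  ∑ B (λ b → intervalCount s (u ∩ b) m) ≡ ∑ (subsets v) (λ T → inInterval s u m T * replication B T)
∑-intervalCount-∩ {v} B s u m = begin
  ∑ B (λ b → ∑ (subsets v) (inInterval s (u ∩ b) m))
    ≡⟨ ∑-cong B (λ b → ∑-cong (subsets v) (inInterval-∩ s u b m)) ⟩
  ∑ B (λ b → ∑ (subsets v) (λ T → inInterval s u m T * 𝟙 (T ⊆? b)))
    ≡⟨ ∑-swap B (subsets v) _ ⟩
  ∑ (subsets v) (λ T → ∑ B (λ b → inInterval s u m T * 𝟙 (T ⊆? b)))
    ≡⟨ ∑-cong (subsets v) (λ T → ∑-*ˡ B (inInterval s u m T) _) ⟩
  ∑ (subsets v) (λ T → inInterval s u m T * replication B T) ∎
  where open ≡-Reasoning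

∑-inInterval-* : ∀ {v} (s u : Subset v) m (f : Subset v → ℕ) c → (∀ T → ∣ T ∣ ≡ m → f T ≡ c) →
  ∑ (subsets v) (λ T → inInterval s u m T * f T) ≡ intervalCount s u m * c
∑-inInterval-* {v} s u m f c f≡c = trans
  (∑-cong (subsets v) λ T →
    𝟙-*-cong (s ⊆? T ×-dec T ⊆? u ×-dec ∣ T ∣ ≟ m) λ (_ , _ , ∣T∣≡m) → f≡c T ∣T∣≡m)
  (∑-*ʳ (subsets v) c (inInterval s u m))

⊕-identityʳ : ∀ {n} (x : Subset n) → x ⊕ ⊥ ≡ x
⊕-identityʳ = zipWith-identityʳ xor-identityʳ

⊕-cancelˡ : ∀ {n} (x y : Subset n) → x ⊕ (x ⊕ y) ≡ y
⊕-cancelˡ []       []       = refl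
⊕-cancelˡ (a ∷ x) (b ∷ y) =
  cong₂ _∷_ (trans (sym (xor-assoc a a b)) (cong (_xor b) (xor-same a))) (⊕-cancelˡ x y)

∩-distribˡ-⊕ : ∀ {n} (z x y : Subset n) → z ∩ (x ⊕ y) ≡ (z ∩ x) ⊕ (z ∩ y)
∩-distribˡ-⊕ = zipWith-distribˡ ∧-distribˡ-xor

∣⊕∣+2∣∩∣ : ∀ {n} (x y : Subset n) → ∣ x ⊕ y ∣ + 2 * ∣ x ∩ y ∣ ≡ ∣ x ∣ + ∣ y ∣
∣⊕∣+2∣∩∣ []            []            = refl
∣⊕∣+2∣∩∣ (outside ∷ x) (outside ∷ y) = ∣⊕∣+2∣∩∣ x y
∣⊕∣+2∣∩∣ (outside ∷ x) (inside ∷ y)  = trans (cong suc (∣⊕∣+2∣∩∣ x y)) (sym (+-suc ∣ x ∣ ∣ y ∣))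
∣⊕∣+2∣∩∣ (inside ∷ x)  (outside ∷ y) = cong suc (∣⊕∣+2∣∩∣ x y)
∣⊕∣+2∣∩∣ (inside ∷ x)  (inside ∷ y)  = begin
  ∣ x ⊕ y ∣ + 2 * suc ∣ x ∩ y ∣         ≡⟨ cong (∣ x ⊕ y ∣ +_) (*-suc 2 ∣ x ∩ y ∣) ⟩
  ∣ x ⊕ y ∣ + (2 + 2 * ∣ x ∩ y ∣)       ≡⟨ +-suc ∣ x ⊕ y ∣ _ ⟩
  suc (∣ x ⊕ y ∣ + suc (2 * ∣ x ∩ y ∣)) ≡⟨ cong suc (+-suc ∣ x ⊕ y ∣ _) ⟩
  suc (suc (∣ x ⊕ y ∣ + 2 * ∣ x ∩ y ∣)) ≡⟨ cong (suc ∘ suc) (∣⊕∣+2∣∩∣ x y) ⟩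
  suc (suc (∣ x ∣ + ∣ y ∣))             ≡⟨ cong suc (sym (+-suc ∣ x ∣ ∣ y ∣)) ⟩
  suc (∣ x ∣ + suc ∣ y ∣)               ∎
  where open ≡-Reasoning

∣⊤⊕x∣+∣x∣≡n : ∀ {n} (x : Subset n) → ∣ ⊤ ⊕ x ∣ + ∣ x ∣ ≡ n
∣⊤⊕x∣+∣x∣≡n []            = refl
∣⊤⊕x∣+∣x∣≡n (outside ∷ x) = cong suc (∣⊤⊕x∣+∣x∣≡n x)
∣⊤⊕x∣+∣x∣≡n (inside ∷ x)  = trans (+-suc ∣ ⊤ ⊕ x ∣ ∣ x ∣) (cong suc (∣⊤⊕x∣+∣x∣≡n x))

parity-2* : ∀ m → parity (2 * m) ≡ 0ℙ
parity-2* m = ℙ.*-homo-* 2 m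

2∣⇒parity≡0ℙ : ∀ {n} → 2 ∣ n → parity n ≡ 0ℙ
2∣⇒parity≡0ℙ (divides q refl) = trans (cong parity (*-comm q 2)) (parity-2* q)

parity≡0ℙ⇒2∣ : ∀ n → parity n ≡ 0ℙ → 2 ∣ n
parity≡0ℙ⇒2∣ zero          _ = divides 0 refl
parity≡0ℙ⇒2∣ (suc zero)    ()
parity≡0ℙ⇒2∣ (suc (suc n)) p = ∣m∣n⇒∣m+n {2} {2} ∣-refl (parity≡0ℙ⇒2∣ n p)

4∣2*⇒2∣ : ∀ m → 4 ∣ 2 * m → 2 ∣ m
4∣2*⇒2∣ m (divides q 2m≡4q) =
  divides q (*-cancelˡ-≡ m (q * 2) 2 (trans 2m≡4q (sym (trans (*-comm 2 (q * 2)) (*-assoc q 2 2)))))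

parity-∣⊕∣ : ∀ {n} (x y : Subset n) → parity ∣ x ⊕ y ∣ ≡ parity ∣ x ∣ ℙ.+ parity ∣ y ∣
parity-∣⊕∣ x y = begin
  parity ∣ x ⊕ y ∣                            ≡⟨ sym (ℙ.+-identityʳ _) ⟩
  parity ∣ x ⊕ y ∣ ℙ.+ 0ℙ                     ≡⟨ cong (p ℙ.+_) (sym (parity-2* ∣ x ∩ y ∣)) ⟩
  parity ∣ x ⊕ y ∣ ℙ.+ parity (2 * ∣ x ∩ y ∣) ≡⟨ sym (ℙ.+-homo-+ ∣ x ⊕ y ∣ _) ⟩
  parity (∣ x ⊕ y ∣ + 2 * ∣ x ∩ y ∣)          ≡⟨ cong parity (∣⊕∣+2∣∩∣ x y) ⟩
  parity (∣ x ∣ + ∣ y ∣)                      ≡⟨ ℙ.+-homo-+ ∣ x ∣ ∣ y ∣ ⟩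
  parity ∣ x ∣ ℙ.+ parity ∣ y ∣               ∎
  where
  open ≡-Reasoning
  p = parity ∣ x ⊕ y ∣

⟨_,_⟩ : ∀ {n} → Subset n → Subset n → Parity
⟨ x , y ⟩ = parity ∣ x ∩ y ∣

⟨⟩-comm : ∀ {n} (x y : Subset n) → ⟨ x , y ⟩ ≡ ⟨ y , x ⟩
⟨⟩-comm x y = cong (parity ∘ ∣_∣) (∩-comm x y)

⟨⟩-⊕ʳ : ∀ {n} (z x y : Subset n) → ⟨ z , x ⊕ y ⟩ ≡ ⟨ z , x ⟩ ℙ.+ ⟨ z , y ⟩
⟨⟩-⊕ʳ z x y = trans (cong (parity ∘ ∣_∣) (∩-distribˡ-⊕ z x y)) (parity-∣⊕∣ (z ∩ x) (z ∩ y))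

⟨⟩-⊕ˡ : ∀ {n} (x y z : Subset n) → ⟨ x ⊕ y , z ⟩ ≡ ⟨ x , z ⟩ ℙ.+ ⟨ y , z ⟩
⟨⟩-⊕ˡ x y z = trans (⟨⟩-comm (x ⊕ y) z) (trans (⟨⟩-⊕ʳ z x y) (cong₂ ℙ._+_ (⟨⟩-comm z x) (⟨⟩-comm z y)))

⟨⟩-⊥ʳ : ∀ {n} (z : Subset n) → ⟨ z , ⊥ ⟩ ≡ 0ℙ
⟨⟩-⊥ʳ {n} z = cong parity (trans (cong ∣_∣ (∩-zeroʳ z)) (∣⊥∣≡0 n))

nonzero-detected : ∀ {n} (y : Subset n) → y ≢ ⊥ → Σ (Subset n) λ z → ⟨ z , y ⟩ ≡ 1ℙ
nonzero-detected []            y≢⊥ = contradiction refl y≢⊥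
nonzero-detected {suc n} (inside ∷ y) _ =
  inside ∷ ⊥ , cong (parity ∘ suc) (trans (cong ∣_∣ (∩-zeroˡ y)) (∣⊥∣≡0 n))
nonzero-detected (outside ∷ y) y≢⊥ =
  Product.map (outside ∷_) (λ p → p) (nonzero-detected y (y≢⊥ ∘ cong (outside ∷_)))

OrthogonalTo : ∀ {v} → List (Subset v) → Subset v → Set
OrthogonalTo B z = ∀ {b} → b ∈ B → ⟨ z , b ⟩ ≡ 0ℙ

module _ {v : ℕ} {B : List (Subset v)} where

  block∈code : ∀ {b} → b ∈ B → InCode B b
  block∈code {b} b∈B = subst (InCode B) (⊕-identityʳ b) (addC b∈B zeroC)

  orthogonal-code : ∀ {z} → OrthogonalTo B z → ∀ {y} → InCode B y → ⟨ z , y ⟩ ≡ 0ℙ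
  orthogonal-code {z} z⊥B zeroC                 = ⟨⟩-⊥ʳ z
  orthogonal-code {z} z⊥B (addC {b} {y} b∈B y∈C) =
    trans (⟨⟩-⊕ʳ z b y) (cong₂ ℙ._+_ (z⊥B b∈B) (orthogonal-code {z} z⊥B {y} y∈C))

  orthogonal⇒dual : ∀ {z} → OrthogonalTo B z → InDual B z
  orthogonal⇒dual {z} z⊥B y y∈C = parity≡0ℙ⇒2∣ _ (orthogonal-code {z} z⊥B {y} y∈C)

  dual-orthogonal : ∀ {x y} → InDual B x → InCode B y → ⟨ x , y ⟩ ≡ 0ℙ
  dual-orthogonal x∈C⊥ y∈C = 2∣⇒parity≡0ℙ (x∈C⊥ _ y∈C)

  dual-⊕ : ∀ {x y} → InDual B x → InDual B y → InDual B (x ⊕ y)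
  dual-⊕ {x} {y} x∈C⊥ y∈C⊥ z z∈C = parity≡0ℙ⇒2∣ _ (begin
    ⟨ x ⊕ y , z ⟩
      ≡⟨ ⟨⟩-⊕ˡ x y z ⟩
    ⟨ x , z ⟩ ℙ.+ ⟨ y , z ⟩
      ≡⟨ cong₂ ℙ._+_ (dual-orthogonal {x} {z} x∈C⊥ z∈C) (dual-orthogonal {y} {z} y∈C⊥ z∈C) ⟩
    0ℙ ∎)
    where open ≡-Reasoning

InCode-∷ : ∀ {v} {B : List (Subset v)} {b y} → InCode B y → InCode (b ∷ B) y
InCode-∷ zeroC          = zeroC
InCode-∷ (addC b∈B y∈C) = addC (there b∈B) (InCode-∷ y∈C)

∷-orthogonal : ∀ {v} {B : List (Subset v)} {b z} →
  ⟨ z , b ⟩ ≡ 0ℙ → OrthogonalTo B z → OrthogonalTo (b ∷ B) z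
∷-orthogonal ⟨z,b⟩≡0 z⊥B (here refl)  = ⟨z,b⟩≡0
∷-orthogonal ⟨z,b⟩≡0 z⊥B (there b′∈B) = z⊥B b′∈B

separated-∷ : ∀ {v} {B : List (Subset v)} b y {z₁ z₂} →
  OrthogonalTo B z₁ → ⟨ z₁ , y ⟩ ≡ 1ℙ → OrthogonalTo B z₂ → ⟨ z₂ , b ⊕ y ⟩ ≡ 1ℙ →
  Σ (Subset v) λ z → OrthogonalTo (b ∷ B) z × ⟨ z , y ⟩ ≡ 1ℙ
separated-∷ b y {z₁} {z₂} z₁⊥B ⟨z₁,y⟩≡1 z₂⊥B ⟨z₂,b⊕y⟩≡1
  with ⟨ z₁ , b ⟩ in ⟨z₁,b⟩≡ | ⟨ z₂ , b ⟩ in ⟨z₂,b⟩≡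
... | 0ℙ | _  = z₁ , ∷-orthogonal {z = z₁} ⟨z₁,b⟩≡ z₁⊥B , ⟨z₁,y⟩≡1
... | 1ℙ | 0ℙ = z₂ , ∷-orthogonal {z = z₂} ⟨z₂,b⟩≡ z₂⊥B , (begin
  ⟨ z₂ , y ⟩                   ≡⟨ cong (ℙ._+ ⟨ z₂ , y ⟩) (sym ⟨z₂,b⟩≡) ⟩
  ⟨ z₂ , b ⟩ ℙ.+ ⟨ z₂ , y ⟩    ≡⟨ sym (⟨⟩-⊕ʳ z₂ b y) ⟩
  ⟨ z₂ , b ⊕ y ⟩               ≡⟨ ⟨z₂,b⊕y⟩≡1 ⟩
  1ℙ                           ∎)
  where open ≡-Reasoning
... | 1ℙ | 1ℙ = z₁ ⊕ z₂ , ∷-orthogonal {z = z₁ ⊕ z₂} ⟨z₁⊕z₂,b⟩≡0 z₁⊕z₂⊥B , (begin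
  ⟨ z₁ ⊕ z₂ , y ⟩              ≡⟨ ⟨⟩-⊕ˡ z₁ z₂ y ⟩
  ⟨ z₁ , y ⟩ ℙ.+ ⟨ z₂ , y ⟩    ≡⟨ cong (ℙ._+ ⟨ z₂ , y ⟩) (trans ⟨z₁,y⟩≡1 (sym ⟨z₂,b⟩≡)) ⟩
  ⟨ z₂ , b ⟩ ℙ.+ ⟨ z₂ , y ⟩    ≡⟨ sym (⟨⟩-⊕ʳ z₂ b y) ⟩
  ⟨ z₂ , b ⊕ y ⟩               ≡⟨ ⟨z₂,b⊕y⟩≡1 ⟩
  1ℙ                           ∎)
  where
  open ≡-Reasoning
  ⟨z₁⊕z₂,b⟩≡0 : ⟨ z₁ ⊕ z₂ , b ⟩ ≡ 0ℙ
  ⟨z₁⊕z₂,b⟩≡0 = trans (⟨⟩-⊕ˡ z₁ z₂ b) (cong₂ ℙ._+_ ⟨z₁,b⟩≡ ⟨z₂,b⟩≡)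
  z₁⊕z₂⊥B : OrthogonalTo _ (z₁ ⊕ z₂)
  z₁⊕z₂⊥B b′∈B = trans (⟨⟩-⊕ˡ z₁ z₂ _) (cong₂ ℙ._+_ (z₁⊥B b′∈B) (z₂⊥B b′∈B))

code-or-separated : ∀ {v} (B : List (Subset v)) y →
  InCode B y ⊎ Σ (Subset v) λ z → OrthogonalTo B z × ⟨ z , y ⟩ ≡ 1ℙ
code-or-separated [] y with ≡-dec Bool._≟_ y ⊥
... | yes refl = inj₁ zeroC
... | no y≢⊥   = inj₂ (Product.map₂ (λ ⟨z,y⟩≡1 → (λ ()) , ⟨z,y⟩≡1) (nonzero-detected y y≢⊥))
code-or-separated (b ∷ B) y with code-or-separated B y | code-or-separated B (b ⊕ y)
... | inj₁ y∈C | _            = inj₁ (InCode-∷ y∈C)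
... | inj₂ _   | inj₁ b⊕y∈C   =
  inj₁ (subst (InCode (b ∷ B)) (⊕-cancelˡ b y) (addC (here refl) (InCode-∷ b⊕y∈C)))
... | inj₂ (z₁ , z₁⊥B , ⟨z₁,y⟩≡1) | inj₂ (z₂ , z₂⊥B , ⟨z₂,b⊕y⟩≡1) =
  inj₂ (separated-∷ b y {z₁} {z₂} z₁⊥B ⟨z₁,y⟩≡1 z₂⊥B ⟨z₂,b⊕y⟩≡1)

doublyEven⇒even-∩ : ∀ {n} {x y : Subset n} → 4 ∣ ∣ x ∣ → 4 ∣ ∣ y ∣ → 4 ∣ ∣ x ⊕ y ∣ → 2 ∣ ∣ x ∩ y ∣
doublyEven⇒even-∩ {x = x} {y} 4∣x 4∣y 4∣x⊕y = 4∣2*⇒2∣ ∣ x ∩ y ∣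
  (∣m+n∣m⇒∣n (subst (4 ∣_) (sym (∣⊕∣+2∣∩∣ x y)) (∣m∣n⇒∣m+n 4∣x 4∣y)) 4∣x⊕y)

doublyEven-dual⇒dual⊆code : ∀ {v} {B : List (Subset v)} →
  (∀ x → InDual B x → 4 ∣ ∣ x ∣) → ∀ x → InDual B x → InCode B x
doublyEven-dual⇒dual⊆code {B = B} dual-doublyEven x x∈C⊥ with code-or-separated B x
... | inj₁ x∈C = x∈C
... | inj₂ (z , z⊥B , ⟨z,x⟩≡1) = contradiction (trans (sym ⟨z,x⟩≡1) (trans (⟨⟩-comm z x) ⟨x,z⟩≡0)) λ ()
  where
  z∈C⊥ = orthogonal⇒dual {z = z} z⊥B
  ⟨x,z⟩≡0 : ⟨ x , z ⟩ ≡ 0ℙ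
  ⟨x,z⟩≡0 = 2∣⇒parity≡0ℙ (doublyEven⇒even-∩ {x = x} {z}
    (dual-doublyEven x x∈C⊥) (dual-doublyEven z z∈C⊥)
    (dual-doublyEven (x ⊕ z) (dual-⊕ {x = x} {z} x∈C⊥ z∈C⊥)))

zero-solves : ∀ t v k w → SystemSolvable t v k 0 w
zero-solves t v k w = (λ _ → 0) , (λ _ _ → refl) , λ j _ → cong (_* ((k ∸ j) C (t ∸ j)))
  (trans (∑-cong (upTo (suc (k ⊓ w))) λ i → *-zeroʳ (i C j)) (∑-zero (upTo (suc (k ⊓ w)))))

unsolvable⇒0<λ : ∀ {t v k lam w} → ¬ SystemSolvable t v k lam w → 0 < lam
unsolvable⇒0<λ {t} {v} {k} {zero} {w} unsolvable = contradiction (zero-solves t v k w) unsolvable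
unsolvable⇒0<λ {lam = suc _} _ = s≤s z≤n

module Design {t v k lam : ℕ} {B : List (Subset v)} (design : IsDesign t v k lam B) where

  block-size : ∀ {b} → b ∈ B → ∣ b ∣ ≡ k
  block-size = All-lookup (proj₁ (proj₂ design))

  replication-t : ∀ T → ∣ T ∣ ≡ t → replication B T ≡ lam
  replication-t T ∣T∣≡t = trans (sym (length-filter≡∑𝟙 (T ⊆?_) B)) (proj₂ (proj₂ design) T ∣T∣≡t)

  -- replication B S is the paper's λ_j for j = ∣ S ∣; this is its defining formula, denominator cleared.
  replication-cleared : ∀ {j} S → ∣ S ∣ ≡ j → j ≤ t →
    replication B S * ((k ∸ j) C (t ∸ j)) ≡ lam * ((v ∸ j) C (t ∸ j))
  replication-cleared S refl j≤t = begin
    replication B S * ck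
      ≡⟨ sym (∑-*ʳ B ck (λ b → 𝟙 (S ⊆? b))) ⟩
    ∑ B (λ b → 𝟙 (S ⊆? b) * ck)
      ≡⟨ sym (∑-cong-∈ B intervalCount-block) ⟩
    ∑ B (λ b → intervalCount S (⊤ ∩ b) t)
      ≡⟨ ∑-intervalCount-∩ B S ⊤ t ⟩
    ∑ (subsets v) (λ T → inInterval S ⊤ t T * replication B T)
      ≡⟨ ∑-inInterval-* S ⊤ t (replication B) lam replication-t ⟩
    intervalCount S ⊤ t * lam
      ≡⟨ trans (cong (_* lam) (intervalCount-⊤ S t j≤t)) (*-comm cv lam) ⟩
    lam * cv ∎
    where
    open ≡-Reasoning
    ck = (k ∸ ∣ S ∣) C (t ∸ ∣ S ∣)
    cv = (v ∸ ∣ S ∣) C (t ∸ ∣ S ∣)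
    intervalCount-block : ∀ {b} → b ∈ B → intervalCount S (⊤ ∩ b) t ≡ 𝟙 (S ⊆? b) * ck
    intervalCount-block {b} b∈B = begin
      intervalCount S (⊤ ∩ b) t
        ≡⟨ cong (λ u → intervalCount S u t) (∩-identityˡ b) ⟩
      intervalCount S b t
        ≡⟨ intervalCount≡ S b t j≤t ⟩
      𝟙 (S ⊆? b) * ((∣ b ∣ ∸ ∣ S ∣) C (t ∸ ∣ S ∣))
        ≡⟨ cong (λ n → 𝟙 (S ⊆? b) * ((n ∸ ∣ S ∣) C (t ∸ ∣ S ∣))) (block-size b∈B) ⟩
      𝟙 (S ⊆? b) * ck ∎

  ∑-intersection-binomial : ∀ x j → j ≤ t →
    ∑ B (λ b → ∣ x ∩ b ∣ C j) * ((k ∸ j) C (t ∸ j)) ≡ (∣ x ∣ C j) * (lam * ((v ∸ j) C (t ∸ j)))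
  ∑-intersection-binomial x j j≤t = begin
    ∑ B (λ b → ∣ x ∩ b ∣ C j) * ck
      ≡⟨ cong (_* ck) (sym (∑-cong B λ b → intervalCount-⊥ (x ∩ b) j)) ⟩
    ∑ B (λ b → intervalCount ⊥ (x ∩ b) j) * ck
      ≡⟨ cong (_* ck) (∑-intervalCount-∩ B ⊥ x j) ⟩
    ∑ (subsets v) (λ T → inInterval ⊥ x j T * replication B T) * ck
      ≡⟨ sym (∑-*ʳ (subsets v) ck _) ⟩
    ∑ (subsets v) (λ T → inInterval ⊥ x j T * replication B T * ck)
      ≡⟨ ∑-cong (subsets v) (λ T → *-assoc (inInterval ⊥ x j T) _ ck) ⟩
    ∑ (subsets v) (λ T → inInterval ⊥ x j T * (replication B T * ck))
      ≡⟨ ∑-inInterval-* ⊥ x j _ (lam * cv) (λ T ∣T∣≡j → replication-cleared T ∣T∣≡j j≤t) ⟩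
    intervalCount ⊥ x j * (lam * cv)
      ≡⟨ cong (_* (lam * cv)) (intervalCount-⊥ x j) ⟩
    (∣ x ∣ C j) * (lam * cv) ∎
    where
    open ≡-Reasoning
    ck = (k ∸ j) C (t ∸ j)
    cv = (v ∸ j) C (t ∸ j)

  dual-solves : ∀ x → InDual B x → SystemSolvable t v k lam ∣ x ∣
  dual-solves x x∈C⊥ = n , odd-vanish , equations
    where
    n : ℕ → ℕ
    n i = ∑ B (λ b → 𝟙 (∣ x ∩ b ∣ ≟ i))
    odd-vanish : ∀ i → ¬ 2 ∣ i → n i ≡ 0
    odd-vanish i 2∤i = trans
      (∑-cong-∈ B λ b∈B → 𝟙-no (∣ x ∩ _ ∣ ≟ i) λ ∣x∩b∣≡i →
        2∤i (subst (2 ∣_) ∣x∩b∣≡i (x∈C⊥ _ (block∈code b∈B))))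
      (∑-zero B)
    bounded : ∀ {b} → b ∈ B → ∣ x ∩ b ∣ ≤ k ⊓ ∣ x ∣
    bounded {b} b∈B =
      subst (∣ x ∩ b ∣ ≤_) (trans (cong (∣ x ∣ ⊓_) (block-size b∈B)) (⊓-comm ∣ x ∣ k)) (∣p∩q∣≤∣p∣⊓∣q∣ x b)
    equations : ∀ j → j ≤ t → ∑ (upTo (suc (k ⊓ ∣ x ∣))) (λ i → (i C j) * n i) * ((k ∸ j) C (t ∸ j))
                                ≡ lam * ((v ∸ j) C (t ∸ j)) * (∣ x ∣ C j)
    equations j j≤t = begin
      ∑ (upTo (suc (k ⊓ ∣ x ∣))) (λ i → (i C j) * n i) * ck
        ≡⟨ cong (_* ck) (∑-fibres B (λ b → ∣ x ∩ b ∣) (_C j) _ bounded) ⟩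
      ∑ B (λ b → ∣ x ∩ b ∣ C j) * ck
        ≡⟨ ∑-intersection-binomial x j j≤t ⟩
      (∣ x ∣ C j) * (lam * cv)
        ≡⟨ *-comm (∣ x ∣ C j) (lam * cv) ⟩
      lam * cv * (∣ x ∣ C j) ∎
      where
      open ≡-Reasoning
      ck = (k ∸ j) C (t ∸ j)
      cv = (v ∸ j) C (t ∸ j)

  0<λ⇒block : t ≤ v → 0 < lam → Σ (Subset v) (_∈ B)
  0<λ⇒block t≤v 0<lam = ∑-nonempty B (subst (0 <_) (sym (replication-t S ∣S∣≡t)) 0<lam)
    where
    S = proj₁ (subset-of-size t t≤v)
    ∣S∣≡t = proj₂ (subset-of-size t t≤v)

  module SelfOrthogonalEven (self-orthogonal : SelfOrthogonal k B) (2∣k : 2 ∣ k) where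

    blocks-orthogonal : ∀ {b b′} → b ∈ B → b′ ∈ B → ⟨ b , b′ ⟩ ≡ 0ℙ
    blocks-orthogonal {b} {b′} b∈B b′∈B with ≡-dec Bool._≟_ b b′
    ... | yes refl = trans (cong (parity ∘ ∣_∣) (∩-idem b))
                           (2∣⇒parity≡0ℙ (subst (2 ∣_) (sym (block-size b∈B)) 2∣k))
    ... | no b≢b′  = 2∣⇒parity≡0ℙ (m%n≡0⇒n∣m ∣ b ∩ b′ ∣ 2
                       (trans (self-orthogonal b b′ b∈B b′∈B b≢b′) (n∣m⇒m%n≡0 k 2 2∣k)))

    code⊆dual : ∀ {y} → InCode B y → InDual B y
    code⊆dual {y} y∈C = orthogonal⇒dual {z = y} λ {b} b∈B →
      trans (⟨⟩-comm y b) (orthogonal-code {z = b} (blocks-orthogonal b∈B) y∈C)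

    dual-doublyEven : 4 ∣ k → 0 < k → ∀ {b} → b ∈ B →
      (∀ x → InDual B x → 0 < ∣ x ∣ → ∣ x ∣ < v → 4 ∣ ∣ x ∣) → ∀ x → InDual B x → 4 ∣ ∣ x ∣
    dual-doublyEven 4∣k 0<k {b} b∈B 4∣-middle = 4∣-weight
      where
      4∣-below-v : ∀ y → InDual B y → ∣ y ∣ < v → 4 ∣ ∣ y ∣
      4∣-below-v y y∈C⊥ ∣y∣<v with ∣ y ∣ ≟ 0
      ... | yes ∣y∣≡0 = subst (4 ∣_) (sym ∣y∣≡0) (divides 0 refl)
      ... | no ∣y∣≢0  = 4∣-middle y y∈C⊥ (n≢0⇒n>0 ∣y∣≢0) ∣y∣<v

      4∣-full : InDual B ⊤ → 4 ∣ v
      4∣-full ⊤∈C⊥ = subst (4 ∣_) ∣⊤⊕b∣+k≡v (∣m∣n⇒∣m+n (4∣-below-v (⊤ ⊕ b) ⊤⊕b∈C⊥ ∣⊤⊕b∣<v) 4∣k)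
        where
        ⊤⊕b∈C⊥ = dual-⊕ {x = ⊤} {b} ⊤∈C⊥ (code⊆dual (block∈code b∈B))
        ∣⊤⊕b∣+k≡v : ∣ ⊤ ⊕ b ∣ + k ≡ v
        ∣⊤⊕b∣+k≡v = subst (λ m → ∣ ⊤ ⊕ b ∣ + m ≡ v) (block-size b∈B) (∣⊤⊕x∣+∣x∣≡n b)
        ∣⊤⊕b∣<v : ∣ ⊤ ⊕ b ∣ < v
        ∣⊤⊕b∣<v = subst (∣ ⊤ ⊕ b ∣ <_) ∣⊤⊕b∣+k≡v (m<m+n ∣ ⊤ ⊕ b ∣ 0<k)

      4∣-weight : ∀ x → InDual B x → 4 ∣ ∣ x ∣
      4∣-weight x x∈C⊥ with ∣ x ∣ ≟ v
      ... | no ∣x∣≢v  = 4∣-below-v x x∈C⊥ (≤∧≢⇒< (∣p∣≤n x) ∣x∣≢v)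
      ... | yes ∣x∣≡v =
        subst (4 ∣_) (sym ∣x∣≡v) (4∣-full (subst (InDual B) (∣p∣≡n⇒p≡⊤ {p = x} ∣x∣≡v) x∈C⊥))

lemma2p1 : ∀ {t v k lam : ℕ} (B : List (Subset v)) →
    t ≤ k → k ≤ v →
    IsDesign t v k lam B → SelfOrthogonal k B → 4 ∣ k →
    (∀ (w : ℕ) → 0 < w → ¬ SystemSolvable t v k lam w →
       ∀ (x : Subset v) → InDual B x → ∣ x ∣ ≢ w)
    ×
    (1 ≤ t →
     (∀ (w : ℕ) → 0 < w → w < v → ¬ (4 ∣ w) → ¬ SystemSolvable t v k lam w) →
       DoublyEven (InCode B) × SelfDual B)
lemma2p1 {t} {v} {k} {lam} B t≤k k≤v design self-orthogonal 4∣k = part-i , part-ii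
  where
  open Design design
  open SelfOrthogonalEven self-orthogonal (∣-trans (divides 2 refl) 4∣k)

  part-i : ∀ w → 0 < w → ¬ SystemSolvable t v k lam w → ∀ x → InDual B x → ∣ x ∣ ≢ w
  part-i w _ unsolvable x x∈C⊥ refl = unsolvable (dual-solves x x∈C⊥)

  part-ii : 1 ≤ t → (∀ w → 0 < w → w < v → ¬ 4 ∣ w → ¬ SystemSolvable t v k lam w) →
            DoublyEven (InCode B) × SelfDual B
  part-ii 1≤t unsolvable =
    (λ x → 4∣dual x ∘ code⊆dual) , λ x → code⊆dual , doublyEven-dual⇒dual⊆code 4∣dual x
    where
    0<k = ≤-trans 1≤t t≤k
    1<v = ≤-trans (s≤s (s≤s z≤n)) (≤-trans (∣⇒≤ ⦃ >-nonZero 0<k ⦄ 4∣k) k≤v)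
    4∤1 : ¬ 4 ∣ 1
    4∤1 4∣1 with ∣⇒≤ 4∣1
    ... | s≤s ()
    -- λ > 0, since for λ = 0 the zero vector solves the system with w = 1.
    block = proj₂ (0<λ⇒block (≤-trans t≤k k≤v) (unsolvable⇒0<λ (unsolvable 1 (s≤s z≤n) 1<v 4∤1)))
    4∣middle : ∀ x → InDual B x → 0 < ∣ x ∣ → ∣ x ∣ < v → 4 ∣ ∣ x ∣
    4∣middle x x∈C⊥ 0<∣x∣ ∣x∣<v =
      decidable-stable (4 ∣? ∣ x ∣) λ 4∤∣x∣ → unsolvable ∣ x ∣ 0<∣x∣ ∣x∣<v 4∤∣x∣ (dual-solves x x∈C⊥)
    4∣dual : ∀ x → InDual B x → 4 ∣ ∣ x ∣
    4∣dual = dual-doublyEven 4∣k 0<k block 4∣middle
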